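{- Let $f:\{0,1\}^n\to\{1,-1\}$ be a boolean function and $g(x,y)=f(x\oplus y)$. Suppose there is a parity function $\chi_T$, $T\subseteq[n]$, such that $f$ disagrees with $\chi_T$ on $m$ inputs. Then $R^{\|,pub}(g)=O(\log m)$. Equivalently, $R^{\|,pub}(g)=O\bigl(\log\bigl(2^{n-1}(1-\|\hat f\|_\infty)\bigr)\bigr)$. In particular, if $f$ takes the value $1$ (or the value $-1$) on at most $m$ inputs, then $R^{\|,pub}(g)=O(\log m)$.
   Context: $\chi_T(x)=(-1)^{\sum_{i\in T}x_i}$; $\hat f(S)=2^{ -n}\sum_x\chi_S(x)f(x)$; $\|\hat f\|_\infty=\max_S|\hat f(S)|$. $R^{\|,pub}(g)$ is the randomised communication complexity in the simultaneous message passing model with shared public randomness (visible to the referee): Alice holding $x$ and Bob holding $y$ each send one message to a referee who must output $g(x,y)$ with probability at least $2/3$ on every input; cost is total bits sent. -}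

module Defs where

open import Data.Bool using (Bool; true; false; _∧_; _xor_; not; if_then_else_)
open import Data.Nat using (ℕ; zero; suc; _+_; _*_; _^_; _≤_)
open import Data.List using (List; []; _∷_; map; _++_; filter; length)
open import Data.Vec using (Vec; []; _∷_; zipWith; foldr)
open import Data.Fin.Subset using (Subset)
open import Relation.Binary.PropositionalEquality using (_≡_)
open import Relation.Nullary.Decidable using (Dec)
open import Data.Bool.Properties using () renaming (_≟_ to _≟B_)

Bits : ℕ → Set
Bits n = Vec Bool n

data Sign : Set where
  pos : Sign
  neg : Sign

_==S_ : Sign → Sign → Bool
pos ==S pos = true
neg ==S neg = true
_   ==S _   = false

_⊕_ : {n : ℕ} → Bits n → Bits n → Bits n
x ⊕ y = zipWith _xor_ x y

allBits : (n : ℕ) → List (Bits n)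
allBits zero = [] ∷ []
allBits (suc n) = map (false ∷_) (allBits n) ++ map (true ∷_) (allBits n)

count : {n : ℕ} → (Bits n → Bool) → ℕ
count {n} p = length (filter (λ x → p x ≟B true) (allBits n))

χ : {n : ℕ} → Subset n → Bits n → Sign
χ T x = if foldr (λ _ → Bool) _xor_ false (zipWith _∧_ T x) then neg else pos

disagreements : {n : ℕ} → (Bits n → Sign) → Subset n → ℕ
disagreements f T = count (λ x → not (f x ==S χ T x))

-- A simultaneous-message-passing protocol with public randomness:
-- a shared uniformly random string ρ ∈ {0,1}^r (seen by Alice, Bob and referee),
-- Alice sends an a-bit message, Bob a b-bit message, the referee outputs.
record SMPProtocol (n : ℕ) : Set where
  field
    rbits  : ℕ
    alen   : ℕ
    blen   : ℕ
    alice  : Bits n → Bits rbits → Bits alen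
    bob    : Bits n → Bits rbits → Bits blen
    referee : Bits alen → Bits blen → Bits rbits → Sign

open SMPProtocol public

cost : {n : ℕ} → SMPProtocol n → ℕ
cost P = alen P + blen P

-- P computes g with probability at least 2/3 on every input (x , y)
Computes : {n : ℕ} → SMPProtocol n → (Bits n → Bits n → Sign) → Set
Computes P g = ∀ x y →
  2 * 2 ^ rbits P ≤ 3 * count (λ ρ → referee P (alice P x ρ) (bob P y ρ) ρ ==S g x y)

RSMPpub≤ : {n : ℕ} → (Bits n → Bits n → Sign) → ℕ → Set
RSMPpub≤ {n} g k = Σ (SMPProtocol n) (λ P → Computes P g × cost P ≤ k)
  where open import Data.Product using (Σ; _×_)

-- Alice and Bob send the parity bits χ_T(x), χ_T(y) together with k = 3 + ⌊log₂ m⌋ random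
-- linear hash bits of x and y.  By linearity the referee learns χ_T(x ⊕ y) and the hash of
-- z = x ⊕ y, and flips the parity answer iff that hash matches the hash of one of the m
-- points where f ≠ χ_T.  The answer is always right when f(z) ≠ χ_T(z); otherwise it is wrong
-- only if one of those m points, all different from z, collides with z, which by the union
-- bound has probability at most m / 2^k ≤ 1/3.
module Submission where

open import Defs
open import Data.Nat using (ℕ; _+_; _*_)
open import Data.Nat.Logarithm using (⌊log₂_⌋)
open import Data.Product using (Σ)
open import Data.Fin.Subset using (Subset)

open import Algebra.Bundles using (CommutativeRing)
import Algebra.Properties.CommutativeSemigroup as CommutativeSemigroupProperties
open import Data.Bool using (Bool; true; false; _∧_; _∨_; _xor_; not; if_then_else_)
open import Data.Bool.Properties using (∨-zeroʳ; ¬-not; xor-∧-commutativeRing) renaming (_≟_ to _≟B_)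
open import Data.List as List using (List; []; _∷_; _++_; filter; length)
open import Data.List.Properties using (length-++; filter-++)
open import Data.Nat using (zero; suc; _^_; _≤_; _<_; z≤n; NonZero)
open import Data.Nat.Properties
open import Data.Nat.Tactic.RingSolver using (solve-∀)
open import Data.Nat.Logarithm using (⌊log₂⌋-mono-≤; ⌊log₂[2^n]⌋≡n)
open import Data.Product using (_,_)
open import Data.Vec using ([]; _∷_; zipWith; foldr; take; drop)
open import Function using (_∘_; const)
open import Relation.Binary.PropositionalEquality
open import Relation.Nullary using (yes; no; contradiction)

open CommutativeSemigroupProperties +-commutativeSemigroup using ()
  renaming (interchange to +-interchange)
open CommutativeSemigroupProperties *-commutativeSemigroup using ()
  renaming (interchange to *-interchange; x∙yz≈y∙xz to x*[y*z]≡y*[x*z])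
open CommutativeSemigroupProperties
  (CommutativeRing.+-commutativeSemigroup xor-∧-commutativeRing) using ()
  renaming (interchange to xor-interchange)

card : (n : ℕ) → (Bits n → Bool) → ℕ
card zero    p = if p [] then 1 else 0
card (suc n) p = card n (p ∘ (false ∷_)) + card n (p ∘ (true ∷_))

card-cong : ∀ n {p q : Bits n → Bool} → (∀ x → p x ≡ q x) → card n p ≡ card n q
card-cong zero    e rewrite e [] = refl
card-cong (suc n) e = cong₂ _+_ (card-cong n (e ∘ (false ∷_))) (card-cong n (e ∘ (true ∷_)))

card-mono : ∀ n {p q : Bits n → Bool} → (∀ x → p x ≡ true → q x ≡ true) → card n p ≤ card n q
card-mono zero {p} {q} p⇒q with p [] | p⇒q []
... | true  | q[] rewrite q[] refl = ≤-refl
... | false | _                    = z≤n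
card-mono (suc n) p⇒q =
  +-mono-≤ (card-mono n (p⇒q ∘ (false ∷_))) (card-mono n (p⇒q ∘ (true ∷_)))

card-false : ∀ n → card n (const false) ≡ 0
card-false zero = refl
card-false (suc n) rewrite card-false n = refl

card-true : ∀ n → card n (const true) ≡ 2 ^ n
card-true zero = refl
card-true (suc n) rewrite card-true n = cong (2 ^ n +_) (sym (+-identityʳ _))

card-not : ∀ n (p : Bits n → Bool) → card n p + card n (not ∘ p) ≡ 2 ^ n
card-not zero p with p []
... | true  = refl
... | false = refl
card-not (suc n) p = begin
  (card n p₀ + card n p₁) + (card n (not ∘ p₀) + card n (not ∘ p₁))
    ≡⟨ +-interchange (card n p₀) (card n p₁) _ _ ⟩
  (card n p₀ + card n (not ∘ p₀)) + (card n p₁ + card n (not ∘ p₁))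
    ≡⟨ cong₂ _+_ (card-not n p₀) (card-not n p₁) ⟩
  2 ^ n + 2 ^ n
    ≡⟨ cong (2 ^ n +_) (sym (+-identityʳ _)) ⟩
  2 ^ suc n ∎
  where
  open ≡-Reasoning
  p₀ p₁ : Bits n → Bool
  p₀ = p ∘ (false ∷_)
  p₁ = p ∘ (true ∷_)

card-∨ : ∀ n (p q : Bits n → Bool) → card n (λ x → p x ∨ q x) ≤ card n p + card n q
card-∨ zero p q with p [] | q []
... | true  | true  = m≤m+n 1 1
... | true  | false = ≤-refl
... | false | _     = ≤-refl
card-∨ (suc n) p q = begin
  card (suc n) (λ x → p x ∨ q x)
    ≤⟨ +-mono-≤ (card-∨ n (p ∘ (false ∷_)) (q ∘ (false ∷_))) (card-∨ n (p ∘ (true ∷_)) (q ∘ (true ∷_))) ⟩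
  (card n (p ∘ (false ∷_)) + card n (q ∘ (false ∷_))) + (card n (p ∘ (true ∷_)) + card n (q ∘ (true ∷_)))
    ≡⟨ +-interchange (card n (p ∘ (false ∷_))) _ _ _ ⟩
  card (suc n) p + card (suc n) q ∎
  where open ≤-Reasoning

card-take-drop : ∀ a b (p : Bits a → Bool) (q : Bits b → Bool) →
  card (a + b) (λ r → p (take a r) ∧ q (drop a r)) ≡ card a p * card b q
card-take-drop zero b p q with p []
... | true  = sym (+-identityʳ _)
... | false = card-false b
card-take-drop (suc a) b p q =
  trans (cong₂ _+_ (card-take-drop a b (p ∘ (false ∷_)) q) (card-take-drop a b (p ∘ (true ∷_)) q))
        (sym (*-distribʳ-+ (card b q) (card a (p ∘ (false ∷_))) _))

length-filter-map : ∀ {A B : Set} (p : B → Bool) (g : A → B) (xs : List A) →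
  length (filter (λ y → p y ≟B true) (List.map g xs)) ≡ length (filter (λ x → p (g x) ≟B true) xs)
length-filter-map p g [] = refl
length-filter-map p g (x ∷ xs) with p (g x)
... | true  = cong suc (length-filter-map p g xs)
... | false = length-filter-map p g xs

count≡card : ∀ n (p : Bits n → Bool) → count p ≡ card n p
count≡card zero p with p []
... | true  = refl
... | false = refl
count≡card (suc n) p = begin
  length (filter p? (List.map (false ∷_) (allBits n) ++ List.map (true ∷_) (allBits n)))
    ≡⟨ cong length (filter-++ p? (List.map (false ∷_) (allBits n)) _) ⟩
  length (filter p? (List.map (false ∷_) (allBits n)) ++ filter p? (List.map (true ∷_) (allBits n)))
    ≡⟨ length-++ (filter p? (List.map (false ∷_) (allBits n))) ⟩
  length (filter p? (List.map (false ∷_) (allBits n))) + length (filter p? (List.map (true ∷_) (allBits n)))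
    ≡⟨ cong₂ _+_ (trans (length-filter-map p (false ∷_) (allBits n)) (count≡card n _))
                 (trans (length-filter-map p (true ∷_) (allBits n)) (count≡card n _)) ⟩
  card (suc n) p ∎
  where
  open ≡-Reasoning
  p? = λ x → p x ≟B true

exists : (n : ℕ) → (Bits n → Bool) → Bool
exists zero    p = p []
exists (suc n) p = exists n (p ∘ (false ∷_)) ∨ exists n (p ∘ (true ∷_))

exists-intro : ∀ n (p : Bits n → Bool) x → p x ≡ true → exists n p ≡ true
exists-intro zero    p []          px = px
exists-intro (suc n) p (false ∷ x) px rewrite exists-intro n (p ∘ (false ∷_)) x px = refl
exists-intro (suc n) p (true ∷ x)  px rewrite exists-intro n (p ∘ (true ∷_)) x px = ∨-zeroʳ _

-- The union bound, with all probabilities scaled by K.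
card-exists-≤ : ∀ n r K B (Q : Bits n → Bool) (E : Bits n → Bits r → Bool) →
  (∀ d → Q d ≡ true → K * card r (E d) ≤ B) →
  K * card r (λ ρ → exists n (λ d → Q d ∧ E d ρ)) ≤ card n Q * B
card-exists-≤ zero r K B Q E bound with Q [] in Q[]
... | true  = ≤-trans (bound [] Q[]) (≤-reflexive (sym (+-identityʳ B)))
... | false = ≤-reflexive (trans (cong (K *_) (card-false r)) (*-zeroʳ K))
card-exists-≤ (suc n) r K B Q E bound = begin
  K * card r (λ ρ → e₀ ρ ∨ e₁ ρ)
    ≤⟨ *-monoʳ-≤ K (card-∨ r e₀ e₁) ⟩
  K * (card r e₀ + card r e₁)
    ≡⟨ *-distribˡ-+ K (card r e₀) _ ⟩
  K * card r e₀ + K * card r e₁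
    ≤⟨ +-mono-≤ (card-exists-≤ n r K B _ _ (λ d → bound (false ∷ d)))
                (card-exists-≤ n r K B _ _ (λ d → bound (true ∷ d))) ⟩
  card n (Q ∘ (false ∷_)) * B + card n (Q ∘ (true ∷_)) * B
    ≡⟨ *-distribʳ-+ B (card n (Q ∘ (false ∷_))) _ ⟨
  card (suc n) Q * B ∎
  where
  open ≤-Reasoning
  e₀ e₁ : Bits r → Bool
  e₀ ρ = exists n (λ d → Q (false ∷ d) ∧ E (false ∷ d) ρ)
  e₁ ρ = exists n (λ d → Q (true ∷ d) ∧ E (true ∷ d) ρ)

dot : ∀ {n} → Bits n → Bits n → Bool
dot r x = foldr (λ _ → Bool) _xor_ false (zipWith _∧_ r x)

dot-⊕ : ∀ {n} (r x y : Bits n) → dot r (x ⊕ y) ≡ dot r x xor dot r y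
dot-⊕ []          []      []      = refl
dot-⊕ (true ∷ r)  (a ∷ x) (b ∷ y) =
  trans (cong ((a xor b) xor_) (dot-⊕ r x y)) (xor-interchange a b (dot r x) (dot r y))
dot-⊕ (false ∷ r) (_ ∷ x) (_ ∷ y) = dot-⊕ r x y

hash : ∀ k {n} → Bits (k * n) → Bits n → Bits k
hash zero        ρ x = []
hash (suc k) {n} ρ x = dot (take n ρ) x ∷ hash k (drop n ρ) x

hash-⊕ : ∀ k {n} (ρ : Bits (k * n)) (x y : Bits n) → hash k ρ (x ⊕ y) ≡ hash k ρ x ⊕ hash k ρ y
hash-⊕ zero        ρ x y = refl
hash-⊕ (suc k) {n} ρ x y = cong₂ _∷_ (dot-⊕ (take n ρ) x y) (hash-⊕ k (drop n ρ) x y)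

isZero : ∀ {n} → Bits n → Bool
isZero []      = true
isZero (a ∷ u) = not a ∧ isZero u

isZero-⊕-self : ∀ {n} (u : Bits n) → isZero (u ⊕ u) ≡ true
isZero-⊕-self []          = refl
isZero-⊕-self (true ∷ u)  = isZero-⊕-self u
isZero-⊕-self (false ∷ u) = isZero-⊕-self u

isZero-⊕⇒≡ : ∀ {n} (u v : Bits n) → isZero (u ⊕ v) ≡ true → u ≡ v
isZero-⊕⇒≡ []          []          _ = refl
isZero-⊕⇒≡ (true ∷ u)  (true ∷ v)  z = cong (true ∷_) (isZero-⊕⇒≡ u v z)
isZero-⊕⇒≡ (false ∷ u) (false ∷ v) z = cong (false ∷_) (isZero-⊕⇒≡ u v z)

card-dot-false : ∀ n (w : Bits n) → isZero w ≡ false → 2 * card n (λ r → not (dot r w)) ≡ 2 ^ n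
card-dot-false (suc n) (true ∷ w)  _  = cong (2 *_) (card-not n (λ r → not (dot r w)))
card-dot-false (suc n) (false ∷ w) w≢0 =
  cong (2 *_) (trans (cong (c +_) (sym (+-identityʳ c))) (card-dot-false n w w≢0))
  where c = card n (λ r → not (dot r w))

card-hash-zero : ∀ k n (w : Bits n) → isZero w ≡ false →
  2 ^ k * card (k * n) (λ ρ → isZero (hash k ρ w)) ≡ 2 ^ (k * n)
card-hash-zero zero    n w w≢0 = refl
card-hash-zero (suc k) n w w≢0 = begin
  (2 * 2 ^ k) * card (n + k * n) (λ ρ → isZero (hash (suc k) ρ w))
    ≡⟨ cong ((2 * 2 ^ k) *_) (card-take-drop n (k * n) (λ r → not (dot r w)) (λ ρ → isZero (hash k ρ w))) ⟩
  (2 * 2 ^ k) * (card n (λ r → not (dot r w)) * card (k * n) (λ ρ → isZero (hash k ρ w)))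
    ≡⟨ *-interchange 2 (2 ^ k) (card n (λ r → not (dot r w))) _ ⟩
  (2 * card n (λ r → not (dot r w))) * (2 ^ k * card (k * n) (λ ρ → isZero (hash k ρ w)))
    ≡⟨ cong₂ _*_ (card-dot-false n w w≢0) (card-hash-zero k n w w≢0) ⟩
  2 ^ n * 2 ^ (k * n)
    ≡⟨ ^-distribˡ-+-* 2 n (k * n) ⟨
  2 ^ (n + k * n) ∎
  where open ≡-Reasoning

m<2^suc⌊log₂m⌋ : ∀ m → m < 2 ^ suc ⌊log₂ m ⌋
m<2^suc⌊log₂m⌋ m with m <? 2 ^ suc ⌊log₂ m ⌋
... | yes m< = m<
... | no  m≮ = contradiction
  (subst (_≤ ⌊log₂ m ⌋) (⌊log₂[2^n]⌋≡n (suc ⌊log₂ m ⌋)) (⌊log₂⌋-mono-≤ (≮⇒≥ m≮))) 1+n≰n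

error-≤-⅓ : ∀ K .{{_ : NonZero K}} m X Y P →
  Y ≤ X → K * X ≤ m * P → 3 * m ≤ K → 3 * Y ≤ P
error-≤-⅓ K m X Y P Y≤X KX≤mP 3m≤K = *-cancelˡ-≤ K (begin
  K * (3 * Y) ≤⟨ *-monoʳ-≤ K (*-monoʳ-≤ 3 Y≤X) ⟩
  K * (3 * X) ≡⟨ x*[y*z]≡y*[x*z] K 3 X ⟩
  3 * (K * X) ≤⟨ *-monoʳ-≤ 3 KX≤mP ⟩
  3 * (m * P) ≡⟨ *-assoc 3 m P ⟨
  3 * m * P   ≤⟨ *-monoˡ-≤ P 3m≤K ⟩
  K * P       ∎)
  where open ≤-Reasoning

success-≥-⅔ : ∀ G Y P → G + Y ≡ P → 3 * Y ≤ P → 2 * P ≤ 3 * G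
success-≥-⅔ G Y P G+Y≡P 3Y≤P = +-cancelʳ-≤ (3 * Y) (2 * P) (3 * G) (begin
  2 * P + 3 * Y ≤⟨ +-monoʳ-≤ (2 * P) 3Y≤P ⟩
  2 * P + P     ≡⟨ +-comm (2 * P) P ⟩
  3 * P         ≡⟨ cong (3 *_) G+Y≡P ⟨
  3 * (G + Y)   ≡⟨ *-distribˡ-+ 3 G Y ⟩
  3 * G + 3 * Y ∎)
  where open ≤-Reasoning

3*m≤2^[3+⌊log₂m⌋] : ∀ m → 3 * m ≤ 2 ^ (3 + ⌊log₂ m ⌋)
3*m≤2^[3+⌊log₂m⌋] m = begin
  3 * m                 ≤⟨ *-monoˡ-≤ m (n≤1+n 3) ⟩
  4 * m                 ≤⟨ *-monoʳ-≤ 4 (<⇒≤ (m<2^suc⌊log₂m⌋ m)) ⟩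
  4 * 2 ^ suc ⌊log₂ m ⌋ ≡⟨ *-assoc 2 2 (2 ^ suc ⌊log₂ m ⌋) ⟩
  2 ^ (3 + ⌊log₂ m ⌋)   ∎
  where open ≤-Reasoning

cost-bound : ∀ L → (4 + L) + (4 + L) ≤ 8 * (L + 1)
cost-bound L = ≤-trans (m≤m+n _ (6 * L)) (≤-reflexive (identity L))
  where
  identity : ∀ L → (4 + L) + (4 + L) + 6 * L ≡ 8 * (L + 1)
  identity = solve-∀

-- χ T x reduces to sgn (dot T x).
sgn : Bool → Sign
sgn b = if b then neg else pos

==S-refl : ∀ s → (s ==S s) ≡ true
==S-refl pos = refl
==S-refl neg = refl

sgn-xor-disagreement : ∀ s b → sgn (b xor not (s ==S sgn b)) ≡ s
sgn-xor-disagreement pos true  = refl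
sgn-xor-disagreement pos false = refl
sgn-xor-disagreement neg true  = refl
sgn-xor-disagreement neg false = refl

module ParityHashProtocol {n : ℕ} (f : Bits n → Sign) (T : Subset n) where

  m k : ℕ
  m = disagreements f T
  k = 3 + ⌊log₂ m ⌋

  disagrees : Bits n → Bool
  disagrees d = not (f d ==S χ T d)

  collides : Bits (k * n) → Bits k → Bool
  collides ρ h = exists n (λ d → disagrees d ∧ isZero (hash k ρ d ⊕ h))

  decide : Bits (suc k) → Bits (suc k) → Bits (k * n) → Sign
  decide (a ∷ u) (b ∷ v) ρ = sgn ((a xor b) xor collides ρ (u ⊕ v))

  protocol : SMPProtocol n
  protocol = record
    { rbits   = k * n
    ; alen    = suc k
    ; blen    = suc k
    ; alice   = λ x ρ → dot T x ∷ hash k ρ x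
    ; bob     = λ y ρ → dot T y ∷ hash k ρ y
    ; referee = decide
    }

  answer : Bits n → Bits (k * n) → Sign
  answer z ρ = sgn (dot T z xor collides ρ (hash k ρ z))

  output≡answer : ∀ x y ρ → referee protocol (alice protocol x ρ) (bob protocol y ρ) ρ ≡ answer (x ⊕ y) ρ
  output≡answer x y ρ =
    cong₂ (λ a h → sgn (a xor collides ρ h)) (sym (dot-⊕ T x y)) (sym (hash-⊕ k ρ x y))

  answer-correct : ∀ z ρ → collides ρ (hash k ρ z) ≡ disagrees z → answer z ρ ≡ f z
  answer-correct z ρ e =
    trans (cong (λ c → sgn (dot T z xor c)) e) (sgn-xor-disagreement (f z) (dot T z))

  wrong : Bits n → Bits (k * n) → Bool
  wrong z ρ = not (answer z ρ ==S f z)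

  correct⇒¬wrong : ∀ z ρ → answer z ρ ≡ f z → wrong z ρ ≡ false
  correct⇒¬wrong z ρ a rewrite a = cong not (==S-refl (f z))

  wrong⇒collides : ∀ z → disagrees z ≡ false → ∀ ρ → wrong z ρ ≡ true → collides ρ (hash k ρ z) ≡ true
  wrong⇒collides z agrees ρ w = ¬-not λ c →
    contradiction (trans (sym w) (correct⇒¬wrong z ρ (answer-correct z ρ (trans c (sym agrees))))) λ ()

  never-wrong : ∀ z → disagrees z ≡ true → ∀ ρ → wrong z ρ ≡ false
  never-wrong z dz ρ = correct⇒¬wrong z ρ (answer-correct z ρ (trans self-collision (sym dz)))
    where
    self-collision : collides ρ (hash k ρ z) ≡ true
    self-collision = exists-intro n _ z (cong₂ _∧_ dz (isZero-⊕-self (hash k ρ z)))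

  collision-bound : ∀ z → disagrees z ≡ false → ∀ d → disagrees d ≡ true →
    2 ^ k * card (k * n) (λ ρ → isZero (hash k ρ d ⊕ hash k ρ z)) ≤ 2 ^ (k * n)
  collision-bound z dz d dd = ≤-reflexive (trans
    (cong (2 ^ k *_) (card-cong (k * n) (λ ρ → cong isZero (sym (hash-⊕ k ρ d z)))))
    (card-hash-zero k n (d ⊕ z) d≢z))
    where
    d≢z : isZero (d ⊕ z) ≡ false
    d≢z = ¬-not λ d≡z → contradiction
      (trans (sym dd) (trans (cong disagrees (isZero-⊕⇒≡ d z d≡z)) dz)) λ ()

  card-collides-≤ : ∀ z → disagrees z ≡ false →
    2 ^ k * card (k * n) (λ ρ → collides ρ (hash k ρ z)) ≤ m * 2 ^ (k * n)
  card-collides-≤ z dz =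
    subst (λ c → 2 ^ k * card (k * n) (λ ρ → collides ρ (hash k ρ z)) ≤ c * 2 ^ (k * n))
      (sym (count≡card n disagrees))
      (card-exists-≤ n (k * n) (2 ^ k) (2 ^ (k * n)) disagrees _ (collision-bound z dz))

  3*card-wrong≤ : ∀ z → 3 * card (k * n) (wrong z) ≤ 2 ^ (k * n)
  3*card-wrong≤ z with disagrees z in dz
  ... | true  = subst (λ c → 3 * c ≤ 2 ^ (k * n))
                  (sym (trans (card-cong (k * n) (never-wrong z dz)) (card-false (k * n)))) z≤n
  ... | false = error-≤-⅓ (2 ^ k) {{m^n≢0 2 k}} m
                  (card (k * n) (λ ρ → collides ρ (hash k ρ z))) (card (k * n) (wrong z)) (2 ^ (k * n))
                  (card-mono (k * n) (wrong⇒collides z dz)) (card-collides-≤ z dz)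
                  (3*m≤2^[3+⌊log₂m⌋] m)

  correct : Computes protocol (λ x y → f (x ⊕ y))
  correct x y = subst (λ c → 2 * 2 ^ (k * n) ≤ 3 * c) (sym count-right)
    (success-≥-⅔ (card (k * n) right) (card (k * n) (wrong (x ⊕ y))) (2 ^ (k * n))
      (card-not (k * n) right) (3*card-wrong≤ (x ⊕ y)))
    where
    right : Bits (k * n) → Bool
    right ρ = answer (x ⊕ y) ρ ==S f (x ⊕ y)
    count-right : count (λ ρ → referee protocol (alice protocol x ρ) (bob protocol y ρ) ρ ==S f (x ⊕ y))
                ≡ card (k * n) right
    count-right = trans (count≡card (k * n) _)
      (card-cong (k * n) (λ ρ → cong (_==S f (x ⊕ y)) (output≡answer x y ρ)))

proposition4 : Σ ℕ (λ C → (n : ℕ) (f : Bits n → Sign) (T : Subset n) →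
    RSMPpub≤ (λ x y → f (x ⊕ y)) (C * (⌊log₂ disagreements f T ⌋ + 1)))
proposition4 = 8 , λ n f T →
  let open ParityHashProtocol f T in protocol , correct , cost-bound ⌊log₂ m ⌋
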